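{- For all integers $n\ge11$ and odd $p\ge5$, there exists an always connected periodic graph $\mathcal{G}=(G_0,\dots,G_{p-1})$ with $n$ vertices and period $p$, with footprint $G$, such that $c(G)=1$, $\max_{0\le i\le p-1}c(G_i)=2$ and $c(\mathcal{G})=3$.
   Context: All graphs are finite, undirected and reflexive. A periodic graph with period $p\ge1$ is a sequence $\mathcal{G}=(G_0,\dots,G_{p-1})$ of graphs $G_i=(V,E_i)$ on a common vertex set $V$ (its vertices), extended by $G_{i+p}=G_i$ with $p$ minimal; its footprint is $G=(V,\bigcup_iE_i)$, assumed connected. It is always connected if every snapshot $G_i$ is connected. Cops and Robber on a periodic graph with $k$ cops (perfect information): cops choose starting vertices, then the robber; in each round $t=0,1,\dots$ each cop moves to a vertex of $N_{G_{t\bmod p}}[\text{its position}]$, then the robber likewise; the cops win if a cop ever moves onto the robber's vertex. The cop number $c(\cdot)$ is the least $k$ such that $k$ cops have a winning strategy; a static graph is a periodic graph of period $1$. -}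

module Defs where

open import Data.Nat using (ℕ; zero; suc; _+_; _≤_; _<_)
open import Data.Fin using (Fin)
open import Data.Bool using (Bool; true; false; _∨_)
open import Data.Vec using (Vec; _∷_; []; head)
open import Data.Product using (Σ; _×_; _,_; proj₁; proj₂; ∃)
open import Relation.Binary.PropositionalEquality using (_≡_)
open import Relation.Nullary using (¬_)

Graph : ℕ → Set
Graph n = Fin n → Fin n → Bool

IsGraph : ∀ {n} → Graph n → Set
IsGraph {n} G = (∀ (u : Fin n) → G u u ≡ true) × (∀ (u v : Fin n) → G u v ≡ G v u)

data Reach {n} (G : Graph n) : Fin n → Fin n → Set where
  here : ∀ {u} → Reach G u u
  step : ∀ {u v w} → G u v ≡ true → Reach G v w → Reach G u w

Connected : ∀ {n} → Graph n → Set
Connected {n} G = ∀ (u v : Fin n) → Reach G u v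

GraphSeq : ℕ → Set
GraphSeq n = ℕ → Graph n

IsPeriod : ∀ {n} → GraphSeq n → ℕ → Set
IsPeriod {n} G q = ∀ (t : ℕ) (u v : Fin n) → G (t + q) u v ≡ G t u v

HasPeriod : ∀ {n} → GraphSeq n → ℕ → Set
HasPeriod G p = 1 ≤ p × IsPeriod G p × (∀ q → 1 ≤ q → q < p → ¬ IsPeriod G q)

anyBelow : ℕ → (ℕ → Bool) → Bool
anyBelow zero f = false
anyBelow (suc p) f = anyBelow p f ∨ f p

footprint : ∀ {n} → GraphSeq n → ℕ → Graph n
footprint G p u v = anyBelow p (λ i → G i u v)

static : ∀ {n} → Graph n → GraphSeq n
static G t = G

Pos : ℕ → ℕ → Set
Pos k n = Fin k → Fin n

-- History after round t-1 (i.e. at the start of round t):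
-- (C_t , R_t) ∷ (C_{t-1} , R_{t-1}) ∷ ... ∷ (C_0 , R_0)   (newest first)
History : ℕ → ℕ → ℕ → Set
History k n t = Vec (Pos k n × Fin n) (suc t)

record CopStrategy (k n : ℕ) : Set where
  field
    cstart : Pos k n
    cmove  : (t : ℕ) → History k n t → Pos k n

record RobberStrategy (k n : ℕ) : Set where
  field
    rstart : Pos k n → Fin n
    rmove  : (t : ℕ) → Pos k n → History k n t → Fin n

open CopStrategy
open RobberStrategy

LegalCop : ∀ {k n} → GraphSeq n → CopStrategy k n → Set
LegalCop {k} {n} G cs =
  ∀ (t : ℕ) (h : History k n t) (i : Fin k) →
    G t (proj₁ (head h) i) (cmove cs t h i) ≡ true

LegalRobber : ∀ {k n} → GraphSeq n → RobberStrategy k n → Set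
LegalRobber {k} {n} G rs =
  ∀ (t : ℕ) (c : Pos k n) (h : History k n t) →
    G t (proj₂ (head h)) (rmove rs t c h) ≡ true

play : ∀ {k n} → CopStrategy k n → RobberStrategy k n → (t : ℕ) → History k n t
play cs rs zero = (cstart cs , rstart rs (cstart cs)) ∷ []
play cs rs (suc t) =
  let h = play cs rs t
      c = cmove cs t h
  in (c , rmove rs t c h) ∷ h

CaughtAt : ∀ {k n} → CopStrategy k n → RobberStrategy k n → ℕ → Set
CaughtAt {k} cs rs t =
  Σ (Fin k) λ i → cmove cs t (play cs rs t) i ≡ proj₂ (head (play cs rs t))

CopsWin : ∀ {n} → ℕ → GraphSeq n → Set
CopsWin {n} k G =
  Σ (CopStrategy k n) λ cs → LegalCop G cs ×
    (∀ (rs : RobberStrategy k n) → LegalRobber G rs → ∃ λ t → CaughtAt cs rs t)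

CopNumber : ∀ {n} → GraphSeq n → ℕ → Set
CopNumber G m = CopsWin m G × (∀ k → k < m → ¬ CopsWin k G)

Odd : ℕ → Set
Odd p = Σ ℕ λ m → p ≡ suc (m + m)

-- The snapshots are 11-cycles C(s) (vertex x adjacent to x ± s mod 11) for jumps s = 1, …, 5,
-- scheduled with period p as 1, 3, 2, then 5, 4, 5, 4, …, 4, so that every change of snapshot is one
-- of 1→3, 3→2, 2→5, 5→4, 4→5, 4→1. A cycle has cop number 2, and the footprint contains all five
-- jumps, i.e. it is complete. Two cops lose on the periodic graph: for each of the six changes s→s′
-- the robber, wherever the two cops stand, can step along C(s) to a vertex outside both closed
-- C(s′)-neighbourhoods, so at the start of every round no cop is adjacent to him. Three cops win
-- within two rounds. To reach n ≥ 11 vertices, vertex 0 is blown up into a clique of n − 10 twins;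
-- strategies on the 11-vertex core transfer to the blow-up, and all facts about the core are
-- decided by evaluating Boolean checks.

module Submission where

open import Defs
open import Data.Bool using (Bool; true; false; _∧_; _∨_; not; if_then_else_)
open import Data.Bool.Properties using (∧-conicalˡ; ∧-conicalʳ; ∨-comm)
open import Data.Fin using (Fin; zero; suc; toℕ; fromℕ<; splitAt; _↑ˡ_; #_)
open import Data.Fin.Properties using (_≟_; splitAt-↑ˡ; toℕ<n)
open import Data.Maybe using (Maybe; just; nothing; fromMaybe; is-just)
import Data.Maybe as Maybe
open import Data.Nat using (ℕ; zero; suc; _+_; _∸_; _≤_; _<_; _<ᵇ_; _%_; z≤n; s≤s; NonZero)
open import Data.Nat.DivMod using (m%n<n; n%n≡0; [m+n]%n≡m%n; m<n⇒m%n≡m; %-distribˡ-+)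
open import Data.Nat.Properties
  using (≤-refl; ≤-trans; m≤m+n; m≤n⇒m<n∨m≡n; m≤n⇒∃[o]m+o≡n; +-suc; suc-injective)
open import Data.Product using (Σ; ∃; _×_; _,_; proj₁; proj₂)
open import Data.Sum using (_⊎_; inj₁; inj₂; [_,_]′)
open import Data.Vec using (head)
open import Data.Vec.Functional using ([]; _∷_)
open import Function using (_∘_; id; const; mk⇔)
open import Relation.Nullary using (¬_; does; yes; no; contradiction)
open import Relation.Nullary.Decidable using (dec-true; does-⇔)
open import Relation.Binary.PropositionalEquality

open CopStrategy
open RobberStrategy

allᵇ : ∀ {k} → (Fin k → Bool) → Bool
allᵇ {zero} f = true
allᵇ {suc k} f = f zero ∧ allᵇ (f ∘ suc)

anyᵇ : ∀ {k} → (Fin k → Bool) → Bool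
anyᵇ {zero} f = false
anyᵇ {suc k} f = f zero ∨ anyᵇ (f ∘ suc)

allᵇ-sound : ∀ {k} (f : Fin k → Bool) → allᵇ f ≡ true → ∀ i → f i ≡ true
allᵇ-sound f h zero = ∧-conicalˡ _ _ h
allᵇ-sound f h (suc i) = allᵇ-sound (f ∘ suc) (∧-conicalʳ _ _ h) i

∨-sound : ∀ {a b} → a ∨ b ≡ true → a ≡ true ⊎ b ≡ true
∨-sound {true} _ = inj₁ refl
∨-sound {false} h = inj₂ h

∨-resolveˡ : ∀ {a b} → a ≡ false → a ∨ b ≡ true → b ≡ true
∨-resolveˡ refl h = h

not-true : ∀ {b} → not b ≡ true → b ≡ false
not-true {false} _ = refl

anyᵇ-sound : ∀ {k} (f : Fin k → Bool) → anyᵇ f ≡ true → ∃ λ i → f i ≡ true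
anyᵇ-sound {suc k} f h with ∨-sound {f zero} h
... | inj₁ f0 = zero , f0
... | inj₂ rest with anyᵇ-sound (f ∘ suc) rest
... | i , fi = suc i , fi

anyᵇ-false : ∀ {k} (f : Fin k → Bool) → (∀ i → f i ≡ false) → anyᵇ f ≡ false
anyᵇ-false {zero} f h = refl
anyᵇ-false {suc k} f h rewrite h zero = anyᵇ-false (f ∘ suc) (h ∘ suc)

find : ∀ {k} → (Fin k → Bool) → Maybe (Fin k)
find {zero} f = nothing
find {suc k} f = if f zero then just zero else Maybe.map suc (find (f ∘ suc))

find-sound : ∀ {k} (f : Fin k → Bool) {x} → find f ≡ just x → f x ≡ true
find-sound {suc k} f h with f zero in e
find-sound {suc k} f refl | true = e
... | false with find (f ∘ suc) in e′
find-sound {suc k} f refl | false | just y = find-sound (f ∘ suc) e′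
find-sound {suc k} f () | false | nothing

is-just-find : ∀ {k} (f : Fin k → Bool) → is-just (find f) ≡ true → ∃ λ x → f x ≡ true
is-just-find f h with find f in e
... | just x = x , find-sound f e

≟-sound : ∀ {c} {x y : Fin c} → does (x ≟ y) ≡ true → x ≡ y
≟-sound {x = x} {y} h with x ≟ y
... | yes x≡y = x≡y

≟-false : ∀ {c} {x y : Fin c} → x ≢ y → does (x ≟ y) ≡ false
≟-false {x = x} {y} x≢y with x ≟ y
... | yes x≡y = contradiction x≡y x≢y
... | no _ = refl

-- Positions are functions, so a check over all positions can only speak about their canonical
-- rebuilding, which agrees with the original pointwise.
canonical : ∀ {k c} → Pos k c → Pos k c
canonical {zero} D = []
canonical {suc k} D = D zero ∷ canonical (D ∘ suc)

canonical-≗ : ∀ {k c} (D : Pos k c) i → canonical D i ≡ D i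
canonical-≗ D zero = refl
canonical-≗ D (suc i) = canonical-≗ (D ∘ suc) i

allPosᵇ : ∀ {k c} → (Pos k c → Bool) → Bool
allPosᵇ {zero} f = f []
allPosᵇ {suc k} f = allᵇ (λ a → allPosᵇ (f ∘ (a ∷_)))

allPosᵇ-sound : ∀ {k c} (f : Pos k c → Bool) → allPosᵇ f ≡ true → ∀ D → f (canonical D) ≡ true
allPosᵇ-sound {zero} f h D = h
allPosᵇ-sound {suc k} f h D = allPosᵇ-sound (f ∘ (D zero ∷_)) (allᵇ-sound _ h (D zero)) (D ∘ suc)

ReflexiveSeq : ∀ {n} → GraphSeq n → Set
ReflexiveSeq G = ∀ t u → G t u u ≡ true

Safe : ∀ {k n} → GraphSeq n → ℕ → Pos k n → Fin n → Set
Safe G t C r = ∀ i → G t (C i) r ≡ false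

Moves : ∀ {k n} → GraphSeq n → ℕ → Pos k n → Pos k n → Set
Moves G t C D = ∀ i → G t (C i) (D i) ≡ true

safe-uncaught : ∀ {k n} {G : GraphSeq n} {t C D r} → Safe {k} G t C r → Moves G t C D → ∀ i → D i ≢ r
safe-uncaught safe moves i refl = contradiction (trans (sym (moves i)) (safe i)) λ ()

record Evasion {n} (k : ℕ) (G : GraphSeq n) : Set where
  field
    start      : Pos k n → Fin n
    start-safe : ∀ C → Safe G 0 C (start C)
    flee       : ℕ → Pos k n → Fin n → Fin n
    flee-legal : ∀ t D r → G t r (flee t D r) ≡ true
    flee-safe  : ∀ t C D r → Safe G t C r → Moves G t C D → Safe G (suc t) D (flee t D r)

evasion⇒¬copsWin : ∀ {n k} {G : GraphSeq n} → Evasion k G → ¬ CopsWin k G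
evasion⇒¬copsWin {G = G} ev (cs , cs-legal , wins) = uncaught (wins rs rs-legal)
  where
    open Evasion ev
    rs : RobberStrategy _ _
    rs = record { rstart = start ; rmove = λ t D h → flee t D (proj₂ (head h)) }
    rs-legal : LegalRobber G rs
    rs-legal t D h = flee-legal t D (proj₂ (head h))
    always-safe : ∀ t → Safe G t (proj₁ (head (play cs rs t))) (proj₂ (head (play cs rs t)))
    always-safe zero = start-safe (cstart cs)
    always-safe (suc t) = flee-safe t _ _ _ (always-safe t) (cs-legal t (play cs rs t))
    uncaught : ¬ ∃ (CaughtAt cs rs)
    uncaught (t , i , caught) = safe-uncaught {G = G} (always-safe t) (cs-legal t (play cs rs t)) i caught

evasion₀ : ∀ {n} {G : GraphSeq (suc n)} → ReflexiveSeq G → Evasion 0 G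
evasion₀ refl-G = record
  { start = λ _ → zero ; start-safe = λ _ ()
  ; flee = λ _ _ r → r ; flee-legal = λ t _ r → refl-G t r ; flee-safe = λ _ _ _ _ _ _ () }

evasion-weaken : ∀ {n k} {G : GraphSeq n} → Evasion (suc (suc k)) G → Evasion (suc k) G
evasion-weaken {G = G} ev = record
  { start = λ C → start (C zero ∷ C)
  ; start-safe = λ C i → start-safe (C zero ∷ C) (suc i)
  ; flee = λ t D → flee t (D zero ∷ D)
  ; flee-legal = λ t D → flee-legal t (D zero ∷ D)
  ; flee-safe = λ t C D r safe moves i →
      flee-safe t (C zero ∷ C) (D zero ∷ D) r (safe-doubled safe) (moves-doubled moves) (suc i) }
  where
    open Evasion ev
    safe-doubled : ∀ {k t C r} → Safe {suc k} G t C r → Safe G t (C zero ∷ C) r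
    safe-doubled safe zero = safe zero
    safe-doubled safe (suc i) = safe i
    moves-doubled : ∀ {k t C D} → Moves {suc k} G t C D → Moves G t (C zero ∷ C) (D zero ∷ D)
    moves-doubled moves zero = moves zero
    moves-doubled moves (suc i) = moves i

evasion-mono : ∀ {n j k} {G : GraphSeq (suc n)} → ReflexiveSeq G → Evasion k G → j ≤ k → Evasion j G
evasion-mono refl-G ev z≤n = evasion₀ refl-G
evasion-mono {k = suc k} refl-G ev (s≤s j≤k) with m≤n⇒m<n∨m≡n (s≤s j≤k)
... | inj₂ refl = ev
... | inj₁ (s≤s (s≤s j<k)) = evasion-mono refl-G (evasion-weaken ev) (s≤s j<k)

copNumber-intro : ∀ {n k} {G : GraphSeq (suc n)} → ReflexiveSeq G →
                  CopsWin (suc k) G → Evasion k G → CopNumber G (suc k)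
copNumber-intro refl-G win ev = win , λ { j (s≤s j≤k) → evasion⇒¬copsWin (evasion-mono refl-G ev j≤k) }

pursue : ∀ {c} → Graph c → Fin c → Fin c → Fin c → Fin c
pursue B target x r = if B x r then r else (if B x target then target else x)

pursue-legal : ∀ {c} (B : Graph c) target x r → B x x ≡ true → B x (pursue B target x r) ≡ true
pursue-legal B target x r Bxx with B x r in Bxr
... | true = Bxr
... | false with B x target in Bxt
... | true = Bxt
... | false = Bxx

pursue-catches : ∀ {c} (B : Graph c) target x r → B x r ≡ true → pursue B target x r ≡ r
pursue-catches B target x r Bxr rewrite Bxr = refl

dominating⇒copsWin₁ : ∀ {n} {G : GraphSeq n} z → ReflexiveSeq G → (∀ t v → G t z v ≡ true) → CopsWin 1 G
dominating⇒copsWin₁ {G = G} z refl-G dominates = cs , cs-legal , λ rs _ → 0 , caught rs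
  where
    cs : CopStrategy 1 _
    cs = record { cstart = λ _ → z
                ; cmove = λ t h i → pursue (G t) (proj₁ (head h) i) (proj₁ (head h) i) (proj₂ (head h)) }
    cs-legal : LegalCop G cs
    cs-legal t h i = pursue-legal (G t) _ _ _ (refl-G t _)
    caught : ∀ rs → CaughtAt cs rs 0
    caught rs = zero , pursue-catches (G 0) z z _ (dominates 0 _)

Reach-trans : ∀ {c} {B : Graph c} {x y z} → Reach B x y → Reach B y z → Reach B x z
Reach-trans here y⇝z = y⇝z
Reach-trans (step e x⇝y) y⇝z = step e (Reach-trans x⇝y y⇝z)

connected-via : ∀ {c} {B : Graph c} (hub : Fin c) → (∀ x → Reach B x hub × Reach B hub x) → Connected B
connected-via hub reach x y = Reach-trans (proj₁ (reach x)) (proj₂ (reach y))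

reachᵇ : ∀ {c} → Graph c → ℕ → Fin c → Fin c → Bool
reachᵇ B zero x y = does (x ≟ y)
reachᵇ B (suc d) x y = does (x ≟ y) ∨ anyᵇ (λ w → B x w ∧ reachᵇ B d w y)

reachᵇ-sound : ∀ {c} (B : Graph c) d {x y} → reachᵇ B d x y ≡ true → Reach B x y
reachᵇ-sound B zero {x} h = subst (Reach B x) (≟-sound h) here
reachᵇ-sound B (suc d) {x} {y} h with ∨-sound {does (x ≟ y)} h
... | inj₁ x≡y = subst (Reach B x) (≟-sound x≡y) here
... | inj₂ via with anyᵇ-sound (λ w → B x w ∧ reachᵇ B d w y) via
... | w , Bxw∧w⇝y = step (∧-conicalˡ _ _ Bxw∧w⇝y) (reachᵇ-sound B d (∧-conicalʳ _ _ Bxw∧w⇝y))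

anyBelow-intro : ∀ p (f : ℕ → Bool) i → i < p → f i ≡ true → anyBelow p f ≡ true
anyBelow-intro (suc p) f i (s≤s i≤p) fi with m≤n⇒m<n∨m≡n i≤p
... | inj₁ i<p rewrite anyBelow-intro p f i i<p fi = refl
... | inj₂ refl rewrite fi = ∨-comm (anyBelow p f) true

safeᵇ : ∀ {k c} → Graph c → Pos k c → Fin c → Bool
safeᵇ B C x = allᵇ (λ i → not (B (C i) x))

escapeᵇ : ∀ {k c} → Graph c → Graph c → Pos k c → Fin c → Fin c → Bool
escapeᵇ B B′ D r x = B r x ∧ safeᵇ B′ D x

safeStartᵇ : ∀ {k c} → Graph c → Bool
safeStartᵇ {k} B = allPosᵇ {k} (λ C → is-just (find (safeᵇ B C)))

occupiedᵇ : ∀ {k c} → Pos k c → Fin c → Bool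
occupiedᵇ D r = anyᵇ (λ i → does (D i ≟ r))

escapableᵇ : ∀ {k c} → Graph c → Graph c → Pos k c → Fin c → Bool
escapableᵇ B B′ D r = occupiedᵇ D r ∨ is-just (find (escapeᵇ B B′ D r))

safeStepᵇ : ∀ {k c} → Graph c → Graph c → Bool
safeStepᵇ {k} B B′ = allPosᵇ {k} (λ D → allᵇ (escapableᵇ B B′ D))

safeStepᵇ-sound : ∀ {k c} (B B′ : Graph c) → safeStepᵇ {k} B B′ ≡ true →
                  ∀ D r → escapableᵇ B B′ (canonical D) r ≡ true
safeStepᵇ-sound {k} B B′ h D = allᵇ-sound _ (allPosᵇ-sound {k} (λ D → allᵇ (escapableᵇ B B′ D)) h D)

safeᵇ-canonical : ∀ {k c} (B : Graph c) (C : Pos k c) {x} → safeᵇ B (canonical C) x ≡ true →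
                  ∀ i → B (C i) x ≡ false
safeᵇ-canonical B C {x} h i =
  subst (λ y → B y x ≡ false) (canonical-≗ C i) (not-true (allᵇ-sound _ h i))

evasion-by-search : ∀ {k c} (A : ℕ → Graph c) → ReflexiveSeq A →
                    safeStartᵇ {k} (A 0) ≡ true → (∀ t → safeStepᵇ {k} (A t) (A (suc t)) ≡ true) →
                    Evasion k A
evasion-by-search {k} {c} A refl-A start-ok step-ok = record
  { start = proj₁ ∘ safe-start ; start-safe = λ C → safeᵇ-canonical (A 0) C (proj₂ (safe-start C))
  ; flee = flee ; flee-legal = flee-legal ; flee-safe = flee-safe }
  where
    safe-start : ∀ (C : Pos k c) → ∃ λ x → safeᵇ (A 0) (canonical C) x ≡ true
    safe-start C = is-just-find _ (allPosᵇ-sound (λ C → is-just (find (safeᵇ (A 0) C))) start-ok C)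

    flee : ℕ → Pos k c → Fin c → Fin c
    flee t D r = fromMaybe r (find (escapeᵇ (A t) (A (suc t)) (canonical D) r))

    flee-legal : ∀ t D r → A t r (flee t D r) ≡ true
    flee-legal t D r with find (escapeᵇ (A t) (A (suc t)) (canonical D) r) in e
    ... | just x = ∧-conicalˡ _ _ (find-sound (escapeᵇ (A t) (A (suc t)) (canonical D) r) e)
    ... | nothing = refl-A t r

    flee-safe : ∀ t C D r → Safe A t C r → Moves A t C D → Safe A (suc t) D (flee t D r)
    flee-safe t C D r safe moves with find (escapeᵇ (A t) (A (suc t)) (canonical D) r) in e | escapes
      where
        unoccupied : occupiedᵇ (canonical D) r ≡ false
        unoccupied = anyᵇ-false (λ i → does (canonical D i ≟ r)) λ i →
          ≟-false (λ e → safe-uncaught {G = A} safe moves i (trans (sym (canonical-≗ D i)) e))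
        escapes : is-just (find (escapeᵇ (A t) (A (suc t)) (canonical D) r)) ≡ true
        escapes = ∨-resolveˡ unoccupied (safeStepᵇ-sound (A t) (A (suc t)) (step-ok t) D r)
    ... | just x | _ =
      safeᵇ-canonical (A (suc t)) D (∧-conicalʳ _ _ (find-sound (escapeᵇ (A t) (A (suc t)) (canonical D) r) e))

-- μ t i x r is where cop i, standing at x, moves in round t when the robber is at r.
Rule : ℕ → ℕ → Set
Rule k c = ℕ → Fin k → Fin c → Fin c → Fin c

advance : ∀ {k c} → Rule k c → ℕ → Pos k c → Fin c → Pos k c
advance μ t C r i = μ t i (C i) r

winsWithin : ∀ {k c} → (ℕ → Graph c) → Rule k c → ℕ → ℕ → Pos k c → Fin c → Bool
winsWithin A μ zero t C r = false
winsWithin A μ (suc d) t C r =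
  anyᵇ (λ i → does (μ t i (C i) r ≟ r)) ∨
  allᵇ (λ r′ → not (A t r r′) ∨ winsWithin A μ d (suc t) (advance μ t C r) r′)

winsWithin-unfold : ∀ {k c} {A : ℕ → Graph c} {μ : Rule k c} {d t C r} →
  winsWithin A μ (suc d) t C r ≡ true →
  (∃ λ i → does (μ t i (C i) r ≟ r) ≡ true) ⊎
  (∀ r′ → A t r r′ ≡ true → winsWithin A μ d (suc t) (advance μ t C r) r′ ≡ true)
winsWithin-unfold {A = A} {μ} {d} {t} {C} {r} w with ∨-sound {anyᵇ (λ i → does (μ t i (C i) r ≟ r))} w
... | inj₁ capture = inj₁ (anyᵇ-sound _ capture)
... | inj₂ survives = inj₂ λ r′ adj → ∨-resolveˡ (cong not adj) (allᵇ-sound _ survives r′)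

pursuing : ∀ {k c} → (ℕ → Graph c) → Rule k c → Rule k c
pursuing A target t i x r = pursue (A t) (target t i x r) x r

module Pullback {c n : ℕ} (π : Fin n → Fin c) (ι : Fin c → Fin n) (π∘ι : ∀ x → π (ι x) ≡ x) where

  pullback : Graph c → Graph n
  pullback A u v = A (π u) (π v)

  pullback-isGraph : ∀ {A} → IsGraph A → IsGraph (pullback A)
  pullback-isGraph (refl-A , sym-A) = (λ u → refl-A (π u)) , (λ u v → sym-A (π u) (π v))

  ι-right : ∀ {b} (B : Graph c) y x → B y x ≡ b → B y (π (ι x)) ≡ b
  ι-right B y x h = trans (cong (B y) (π∘ι x)) h

  Reach-ι : ∀ {A : Graph c} {x y} → Reach A x y → Reach (pullback A) (ι x) (ι y)
  Reach-ι here = here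
  Reach-ι {A} {x} (step {v = v} e v⇝y) = step (trans (cong₂ A (π∘ι x) (π∘ι v)) e) (Reach-ι v⇝y)

  pullback-connected : ∀ {A : Graph c} → (∀ x → A x x ≡ true) → Connected A → Connected (pullback A)
  pullback-connected {A} refl-A conn u v =
    step (ι-right A (π u) (π u) (refl-A (π u)))
      (Reach-trans (Reach-ι (conn (π u) (π v)))
        (step (trans (cong (λ z → A z (π v)) (π∘ι (π v))) (refl-A (π v))) here))

  pullback-evasion : ∀ {k} {A : ℕ → Graph c} → Evasion k A → Evasion k (λ t → pullback (A t))
  pullback-evasion {A = A} ev = record
    { start = λ C → ι (start (π ∘ C))
    ; start-safe = λ C i → ι-right (A 0) _ _ (start-safe (π ∘ C) i)
    ; flee = λ t D r → ι (flee t (π ∘ D) (π r))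
    ; flee-legal = λ t D r → ι-right (A t) _ _ (flee-legal t (π ∘ D) (π r))
    ; flee-safe = λ t C D r safe moves i →
        ι-right (A (suc t)) _ _ (flee-safe t (π ∘ C) (π ∘ D) (π r) safe moves i) }
    where open Evasion ev

  module _ {k} (A : ℕ → Graph c) (μ : Rule k c) (μ-legal : ∀ t i x r → A t x (μ t i x r) ≡ true) where

    -- A cop whose core move reaches the robber's projection steps onto the robber himself,
    -- who may stand on a twin of that vertex.
    lift-move : ℕ → Pos k n → Fin n → Pos k n
    lift-move t C R i = if does (μ t i (π (C i)) (π R) ≟ π R) then R else ι (μ t i (π (C i)) (π R))

    π-lift-move : ∀ t C R i → π (lift-move t C R i) ≡ μ t i (π (C i)) (π R)
    π-lift-move t C R i with μ t i (π (C i)) (π R) ≟ π R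
    ... | yes hit = sym hit
    ... | no _ = π∘ι _

    lift-move-catches : ∀ t C R i → does (μ t i (π (C i)) (π R) ≟ π R) ≡ true → lift-move t C R i ≡ R
    lift-move-catches t C R i hit rewrite hit = refl

    pullback-copsWin : (C₀ : Pos k c) (d : ℕ) → (∀ r → winsWithin A μ d 0 C₀ r ≡ true) →
                       CopsWin k (λ t → pullback (A t))
    pullback-copsWin C₀ d wins =
      cs , cs-legal , λ rs rs-legal → chase rs rs-legal d 0 C₀ (λ i → sym (π∘ι (C₀ i))) (wins _)
      where
        cs : CopStrategy k n
        cs = record { cstart = ι ∘ C₀ ; cmove = λ t h → lift-move t (proj₁ (head h)) (proj₂ (head h)) }

        cs-legal : LegalCop (λ t → pullback (A t)) cs
        cs-legal t h i = subst (λ z → A t (π (proj₁ (head h) i)) z ≡ true)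
          (sym (π-lift-move t (proj₁ (head h)) (proj₂ (head h)) i)) (μ-legal t i _ _)

        cops : RobberStrategy k n → ℕ → Pos k n
        cops rs t = proj₁ (head (play cs rs t))

        robber : RobberStrategy k n → ℕ → Fin n
        robber rs t = proj₂ (head (play cs rs t))

        chase : ∀ rs → LegalRobber (λ t → pullback (A t)) rs → ∀ d t (C : Pos k c) →
                (∀ i → C i ≡ π (cops rs t i)) → winsWithin A μ d t C (π (robber rs t)) ≡ true →
                ∃ (CaughtAt cs rs)
        chase rs rs-legal (suc d) t C C≗ w with winsWithin-unfold {A = A} {μ} {d} w
        ... | inj₁ (i , hit) =
          t , i , lift-move-catches t (cops rs t) (robber rs t) i
                    (subst (λ x → does (μ t i x (π (robber rs t)) ≟ π (robber rs t)) ≡ true) (C≗ i) hit)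
        ... | inj₂ survives =
          chase rs rs-legal d (suc t) (advance μ t C (π (robber rs t)))
            (λ i → trans (cong (λ x → μ t i x (π (robber rs t))) (C≗ i))
                         (sym (π-lift-move t (cops rs t) (robber rs t) i)))
            (survives _ (rs-legal t (cmove cs t (play cs rs t)) (play cs rs t)))

pursuing-legal : ∀ {k c} (A : ℕ → Graph c) (target : Rule k c) → ReflexiveSeq A →
                 ∀ t i x r → A t x (pursuing A target t i x r) ≡ true
pursuing-legal A target refl-A t i x r = pursue-legal (A t) _ x r (refl-A t x)

shift : ∀ c .{{_ : NonZero c}} → ℕ → Fin c → Fin c
shift c s x = fromℕ< (m%n<n (toℕ x + s) c)

circulant : ∀ c .{{_ : NonZero c}} → ℕ → Graph c
circulant c s x y = does (x ≟ y) ∨ does (shift c s x ≟ y) ∨ does (shift c s y ≟ x)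

circulant-isGraph : ∀ c .{{_ : NonZero c}} s → IsGraph (circulant c s)
circulant-isGraph c s = reflexive , symmetric
  where
    reflexive : ∀ x → circulant c s x x ≡ true
    reflexive x rewrite dec-true (x ≟ x) refl = refl
    symmetric : ∀ x y → circulant c s x y ≡ circulant c s y x
    symmetric x y = cong₂ _∨_ (does-⇔ (mk⇔ sym sym) (x ≟ y) (y ≟ x))
      (∨-comm (does (shift c s x ≟ y)) (does (shift c s y ≟ x)))

Step : Set
Step = Fin 5

jump : Step → ℕ
jump s = suc (toℕ s)

ring : Step → Graph 11
ring s = circulant 11 (jump s)

ring-reflexive : ∀ s x → ring s x x ≡ true
ring-reflexive s = proj₁ (circulant-isGraph 11 (jump s))

alternation : ℕ → Step
alternation zero = # 4
alternation (suc zero) = # 3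
alternation (suc (suc j)) = alternation j

-- jumps 1, 3, 2, 5, 4, 5, 4, …
schedule : ℕ → Step
schedule zero = # 0
schedule (suc zero) = # 2
schedule (suc (suc zero)) = # 1
schedule (suc (suc (suc j))) = alternation j

data Transition : Step → Step → Set where
  1⇝3 : Transition (# 0) (# 2)
  3⇝2 : Transition (# 2) (# 1)
  2⇝5 : Transition (# 1) (# 4)
  5⇝4 : Transition (# 4) (# 3)
  4⇝5 : Transition (# 3) (# 4)
  4⇝1 : Transition (# 3) (# 0)

alternation-transition : ∀ j → Transition (alternation j) (alternation (suc j))
alternation-transition zero = 5⇝4
alternation-transition (suc zero) = 4⇝5
alternation-transition (suc (suc j)) = alternation-transition j

schedule-transition : ∀ j → Transition (schedule j) (schedule (suc j))
schedule-transition zero = 1⇝3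
schedule-transition (suc zero) = 3⇝2
schedule-transition (suc (suc zero)) = 2⇝5
schedule-transition (suc (suc (suc j))) = alternation-transition j

alternation-odd : ∀ h → alternation (suc (h + h)) ≡ # 3
alternation-odd zero = refl
alternation-odd (suc h) rewrite +-suc h h = alternation-odd h

alternation-lacks-edge₀₁ : ∀ j → ring (alternation j) zero (suc zero) ≡ false
alternation-lacks-edge₀₁ zero = refl
alternation-lacks-edge₀₁ (suc zero) = refl
alternation-lacks-edge₀₁ (suc (suc j)) = alternation-lacks-edge₀₁ j

schedule-lacks-edge₀₁ : ∀ j → ring (schedule (suc j)) zero (suc zero) ≡ false
schedule-lacks-edge₀₁ zero = refl
schedule-lacks-edge₀₁ (suc zero) = refl
schedule-lacks-edge₀₁ (suc (suc j)) = alternation-lacks-edge₀₁ j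

ring-connected : ∀ s → Connected (ring s)
ring-connected s = connected-via zero λ x →
  reachᵇ-sound (ring s) 5 (∧-conicalˡ _ _ (hub x)) , reachᵇ-sound (ring s) 5 (∧-conicalʳ _ _ (hub x))
  where
    hub : ∀ x → reachᵇ (ring s) 5 x zero ∧ reachᵇ (ring s) 5 zero x ≡ true
    hub = allᵇ-sound _
      (allᵇ-sound (λ s → allᵇ λ x → reachᵇ (ring s) 5 x zero ∧ reachᵇ (ring s) 5 zero x) refl s)

ring-evasion₁ : ∀ s → Evasion 1 (λ _ → ring s)
ring-evasion₁ s = evasion-by-search (λ _ → ring s) (λ _ → ring-reflexive s)
  (allᵇ-sound (λ s → safeStartᵇ {1} (ring s)) refl s)
  (λ _ → allᵇ-sound (λ s → safeStepᵇ {1} (ring s) (ring s)) refl s)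

transition-safeStep₂ : ∀ {s s′} → Transition s s′ → safeStepᵇ {2} (ring s) (ring s′) ≡ true
transition-safeStep₂ 1⇝3 = refl
transition-safeStep₂ 3⇝2 = refl
transition-safeStep₂ 2⇝5 = refl
transition-safeStep₂ 5⇝4 = refl
transition-safeStep₂ 4⇝5 = refl
transition-safeStep₂ 4⇝1 = refl

sweep : Step → Rule 2 11
sweep s t zero x r = shift 11 (jump s) x
sweep s t (suc _) x r = shift 11 (11 ∸ jump s) x

sweep-wins : Step → Fin 11 → Bool
sweep-wins s = winsWithin (λ _ → ring s) (pursuing (λ _ → ring s) (sweep s)) 5 0 (zero ∷ zero ∷ [])

ring-sweep-wins : ∀ s r → sweep-wins s r ≡ true
ring-sweep-wins s = allᵇ-sound (sweep-wins s) (allᵇ-sound (λ s → allᵇ (sweep-wins s)) refl s)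

schedule-covers : ∀ y → ∃ λ (i : Fin 5) → ring (schedule (toℕ i)) zero y ≡ true
schedule-covers y =
  anyᵇ-sound _ (allᵇ-sound (λ y → anyᵇ {5} (λ i → ring (schedule (toℕ i)) zero y)) refl y)

-- From 0, 0, 5 the cops move in round 0 (jump 1), unless they capture, to 0, 10 and to 4 or 6
-- according as the robber is below 5 or not; the jump-3 neighbourhoods of these cover every
-- reply of the robber, so round 1 captures.
ambush : Rule 3 11
ambush zero zero x r = x
ambush zero (suc zero) x r = # 10
ambush zero (suc (suc _)) x r = if toℕ r <ᵇ 5 then # 4 else # 6
ambush (suc t) i x r = x

collapse : ∀ {c} m → Fin (suc c + m) → Fin (suc c)
collapse {c} m v = [ id , const zero ]′ (splitAt (suc c) v)

collapse-↑ˡ : ∀ {c} m (x : Fin (suc c)) → collapse m (x ↑ˡ m) ≡ x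
collapse-↑ˡ {c} m x rewrite splitAt-↑ˡ (suc c) x m = refl

odd≥5 : ∀ {p} → 5 ≤ p → Odd p → ∃ λ h → p ≡ 5 + (h + h)
odd≥5 (s≤s ()) (zero , refl)
odd≥5 (s≤s (s≤s (s≤s ()))) (suc zero , refl)
odd≥5 _ (suc (suc h) , refl) = h , cong (3 +_) (trans (+-suc h (suc h)) (cong suc (+-suc h h)))

module Construction (m h : ℕ) where
  -- The literal 11 (not suc 10) keeps the core graphs syntactically equal to those of the checks
  -- above, so that comparing them does not unfold the checks.
  open Pullback {11} {11 + m} (collapse {10} m) (_↑ˡ m) (collapse-↑ˡ m)

  p : ℕ
  p = 5 + (h + h)

  steps : ℕ → Step
  steps t = schedule (t % p)

  core : ℕ → Graph 11
  core t = ring (steps t)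

  𝒢 : GraphSeq (11 + m)
  𝒢 t = pullback (core t)

  core-reflexive : ReflexiveSeq core
  core-reflexive t = ring-reflexive (steps t)

  𝒢-reflexive : ReflexiveSeq 𝒢
  𝒢-reflexive t u = core-reflexive t (collapse m u)

  steps-transition : ∀ t → Transition (steps t) (steps (suc t))
  steps-transition t with m≤n⇒m<n∨m≡n (m%n<n t p)
  ... | inj₁ next<p = subst (Transition (steps t) ∘ schedule)
                        (sym (trans (%-distribˡ-+ 1 t p) (m<n⇒m%n≡m next<p))) (schedule-transition (t % p))
  ... | inj₂ next≡p = subst₂ Transition (sym last) (sym first) 4⇝1
    where
      last : steps t ≡ # 3
      last = trans (cong schedule (suc-injective next≡p)) (alternation-odd h)
      first : steps (suc t) ≡ # 0
      first = cong schedule (trans (%-distribˡ-+ 1 t p) (trans (cong (_% p) next≡p) (n%n≡0 p)))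

  𝒢-period : HasPeriod 𝒢 p
  𝒢-period = s≤s z≤n , periodic , minimal
    where
      periodic : IsPeriod 𝒢 p
      periodic t u v = cong (λ j → ring (schedule j) (collapse m u) (collapse m v)) ([m+n]%n≡m%n t p)
      minimal : ∀ q → 1 ≤ q → q < p → ¬ IsPeriod 𝒢 q
      minimal (suc q) _ q<p q-periodic =
        contradiction (trans (sym absent) (q-periodic 0 (zero ↑ˡ m) (suc zero ↑ˡ m))) λ ()
        where
          absent : 𝒢 (suc q) (zero ↑ˡ m) (suc zero ↑ˡ m) ≡ false
          absent = subst (λ j → ring (schedule j) zero (suc zero) ≡ false)
                     (sym (m<n⇒m%n≡m q<p)) (schedule-lacks-edge₀₁ q)

  ring-copNumber : ∀ s → CopNumber (static (pullback (ring s))) 2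
  ring-copNumber s = copNumber-intro (λ _ u → ring-reflexive s (collapse m u))
    (pullback-copsWin (λ _ → ring s) (pursuing (λ _ → ring s) (sweep s))
      (pursuing-legal (λ _ → ring s) (sweep s) (λ _ → ring-reflexive s)) (zero ∷ zero ∷ []) 5
      (ring-sweep-wins s))
    (pullback-evasion (ring-evasion₁ s))

  snapshot-copNumber : ∀ t → CopNumber (static (𝒢 t)) 2
  snapshot-copNumber t = ring-copNumber (steps t)

  ambush-wins : ∀ r → winsWithin core (pursuing core ambush) 2 0 (zero ∷ zero ∷ # 5 ∷ []) r ≡ true
  ambush-wins = allᵇ-sound (winsWithin core (pursuing core ambush) 2 0 (zero ∷ zero ∷ # 5 ∷ [])) refl

  𝒢-isGraph : ∀ t → IsGraph (𝒢 t)
  𝒢-isGraph t = pullback-isGraph (circulant-isGraph 11 (jump (steps t)))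

  𝒢-connected : ∀ t → Connected (𝒢 t)
  𝒢-connected t = pullback-connected (ring-reflexive (steps t)) (ring-connected (steps t))

  𝒢-copNumber : CopNumber 𝒢 3
  𝒢-copNumber = copNumber-intro 𝒢-reflexive
    (pullback-copsWin core (pursuing core ambush) (pursuing-legal core ambush core-reflexive)
      (zero ∷ zero ∷ # 5 ∷ []) 2 ambush-wins)
    (pullback-evasion (evasion-by-search core core-reflexive refl
      -- explicit implicits: inferring them from the goal would unfold the check symbolically
      (λ t → transition-safeStep₂ {steps t} {steps (suc t)} (steps-transition t))))

  footprint-reflexive : ReflexiveSeq (static (footprint 𝒢 p))
  footprint-reflexive _ u = anyBelow-intro p (λ i → 𝒢 i u u) 0 (s≤s z≤n) (𝒢-reflexive 0 u)

  footprint-dominated : ∀ t v → static (footprint 𝒢 p) t (zero ↑ˡ m) v ≡ true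
  footprint-dominated _ v with schedule-covers (collapse m v)
  ... | i , adjacent = anyBelow-intro p (λ j → 𝒢 j (zero ↑ˡ m) v) (toℕ i) i<p
        (subst (λ j → ring (schedule j) zero (collapse m v) ≡ true) (sym (m<n⇒m%n≡m i<p)) adjacent)
    where
      i<p : toℕ i < p
      i<p = ≤-trans (toℕ<n i) (m≤m+n 5 (h + h))

  footprint-copNumber : CopNumber (static (footprint 𝒢 p)) 1
  footprint-copNumber = copNumber-intro {G = static (footprint 𝒢 p)} footprint-reflexive
    (dominating⇒copsWin₁ {G = static (footprint 𝒢 p)} (zero ↑ˡ m) footprint-reflexive footprint-dominated)
    (evasion₀ footprint-reflexive)

proposition5 : ∀ (n p : ℕ) → 11 ≤ n → 5 ≤ p → Odd p →
    Σ (GraphSeq n) λ G →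
      HasPeriod G p ×
      (∀ i → i < p → IsGraph (G i)) ×
      (∀ i → i < p → Connected (G i)) ×
      CopNumber (static (footprint G p)) 1 ×
      ((∀ i → i < p → Σ ℕ λ m → m ≤ 2 × CopNumber (static (G i)) m) ×
       Σ ℕ (λ i → i < p × CopNumber (static (G i)) 2)) ×
      CopNumber G 3
proposition5 n p 11≤n 5≤p p-odd with m≤n⇒∃[o]m+o≡n 11≤n | odd≥5 5≤p p-odd
... | m , refl | h , refl =
  𝒢 , 𝒢-period ,
  (λ t _ → 𝒢-isGraph t) , (λ t _ → 𝒢-connected t) ,
  footprint-copNumber ,
  ((λ t _ → 2 , ≤-refl , snapshot-copNumber t) , (0 , s≤s z≤n , snapshot-copNumber 0)) ,
  𝒢-copNumber
  where open Construction m h
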